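{- Let $G,H\in\langle\widetilde{\mathrm{Ims}}^\infty\cup\widetilde{\mathrm{LIm}}\rangle$. If $o(G+H)=\mathcal P$ and $o(H+H)=\mathcal P$, then $G\asymp H$.
   Context: Games. Two players, Left and Right, alternate; a position $G$ is determined by its set $G^{\mathcal L}$ of Left options and $G^{\mathcal R}$ of Right options, written $G\cong\{G^{\mathcal L}\mid G^{\mathcal R}\}$. The disjunctive sum is $G+H\cong\{G^{\mathcal L}+H,\,G+H^{\mathcal L}\mid G^{\mathcal R}+H,\,G+H^{\mathcal R}\}$. Normal play: a player with no move loses. The outcome $o(G)$ is $\mathcal N$ if the player to move can force a win, $\mathcal P$ if the other player can, $\mathcal L$ (resp. $\mathcal R$) if Left (resp. Right) can force a win whoever starts, and $\mathcal D$ (draw) if under optimal play neither player can force a win. Nimbers: $*0=0\cong\{\,\mid\,\}$, $*n\cong\{*0,\dots,*(n-1)\mid *0,\dots,*(n-1)\}$. Impartial loopy games: $\widetilde{\mathrm{LIm}}$ is the set of positions of impartial rulesets (Left and Right options coincide) in which play need not terminate. Impartial entailing games: positions (short) built recursively from $\infty$ and $\overline\infty$, immediate wins for Left and Right respectively ($o(\infty)=\mathcal L$, $o(\overline\infty)=\mathcal R$, $\infty+X=\infty$ for $X\neq\overline\infty$, $\overline\infty+X=\overline\infty$ for $X\neq\infty$). Conjugate: $\infty,\overline\infty$ conjugate to each other, otherwise $\overline G=\{\overline{G^{\mathcal R}}\mid\overline{G^{\mathcal L}}\}$. $G$ is symmetric if $G\notin\{\infty,\overline\infty\}$ and $G^{\mathcal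 R}=\overline{G^{\mathcal L}}$; quiet if $G\notin\{\infty,\overline\infty\}$, $\infty\notin G^{\mathcal L}$, $\overline\infty\notin G^{\mathcal R}$. $\widetilde{\mathrm{Im}}^\infty$ = symmetric positions all of whose quiet followers are symmetric; $G=_{\widetilde{\mathrm{Im}}^\infty}H$ iff $o(G+X)=o(H+X)$ for all $X\in\widetilde{\mathrm{Im}}^\infty$. $\mathrm{Moon}\cong\{\infty\mid\overline\infty\}$. Special moon: $\mathrm{SMoon}(n)_A\cong\{\{\infty\mid *n\},A\mid A,\{*n\mid\overline\infty\}\}$, $A$ a set of nimbers and previously constructed special moons with $*n\in A$. $\widetilde{\mathrm{Ims}}^\infty$ is the set of $G\in\widetilde{\mathrm{Im}}^\infty$ with $G=_{\widetilde{\mathrm{Im}}^\infty}*k$ for some $k$, or $G\cong\mathrm{Moon}$, or $G\cong\mathrm{SMoon}(n)_A$ for some $n,A$. $\langle\widetilde{\mathrm{Ims}}^\infty\cup\widetilde{\mathrm{LIm}}\rangle$ is the set of finite sums $G_1+\dots+G_r+H_1+\dots+H_s$ with $G_i\in\widetilde{\mathrm{Ims}}^\infty$, $H_j\in\widetilde{\mathrm{LIm}}$. By convention, $o(\infty+X)=\mathcal L$ and $o(\overline\infty+X)=\mathcal R$ for every $X$ in this set. For $G,H$ in this set, $G\asymp H$ means $o(G+X)=o(H+X)$ for all $X$ in this set. -}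

module Defs where

open import Data.Nat using (ℕ; zero; suc)
open import Data.Fin using (Fin)
open import Data.List using (List; []; _∷_; map; _++_)
open import Data.List.Relation.Unary.All using (All)
open import Data.List.Relation.Unary.Any using (Any)
open import Data.Product using (Σ; _×_; _,_)
open import Data.Sum using (_⊎_)
open import Data.Unit using (⊤)
open import Relation.Nullary using (¬_)
open import Relation.Binary.PropositionalEquality using (_≡_)
open import Function.Bundles using (_⇔_)

data EGame : Set where
  ∞ᴱ  : EGame                          -- ∞  : immediate win for Left
  ∞̄ᴱ  : EGame                          -- ∞̄ : immediate win for Right
  ⟨_∣_⟩ : List EGame → List EGame → EGame

mutual
  conj : EGame → EGame
  conj ∞ᴱ = ∞̄ᴱ
  conj ∞̄ᴱ = ∞ᴱ
  conj ⟨ L ∣ R ⟩ = ⟨ conjs R ∣ conjs L ⟩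

  conjs : List EGame → List EGame
  conjs [] = []
  conjs (g ∷ gs) = conj g ∷ conjs gs

mutual
  data _≅_ : EGame → EGame → Set where
    ∞≅  : ∞ᴱ ≅ ∞ᴱ
    ∞̄≅  : ∞̄ᴱ ≅ ∞̄ᴱ
    node≅ : ∀ {GL GR HL HR} → SetEq GL HL → SetEq GR HR →
            ⟨ GL ∣ GR ⟩ ≅ ⟨ HL ∣ HR ⟩

  data SetEq (xs ys : List EGame) : Set where
    seteq : All (λ x → Any (λ y → x ≅ y) ys) xs →
            All (λ y → Any (λ x → x ≅ y) xs) ys → SetEq xs ys

data Symmetric : EGame → Set where
  sym : ∀ {L R} → SetEq R (conjs L) → Symmetric ⟨ L ∣ R ⟩

data Quiet : EGame → Set where
  quiet : ∀ {L R} → ¬ Any (λ g → g ≡ ∞ᴱ) L → ¬ Any (λ g → g ≡ ∞̄ᴱ) R →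
          Quiet ⟨ L ∣ R ⟩

data Follower : EGame → EGame → Set where
  self  : ∀ {G} → Follower G G
  viaL  : ∀ {L R G' F} → Any (λ g → g ≡ G') L → Follower G' F → Follower ⟨ L ∣ R ⟩ F
  viaR  : ∀ {L R G' F} → Any (λ g → g ≡ G') R → Follower G' F → Follower ⟨ L ∣ R ⟩ F

InIm : EGame → Set
InIm G = Symmetric G × (∀ F → Follower G F → Quiet F → Symmetric F)

mutual
  nim : ℕ → EGame
  nim n = ⟨ nimList n ∣ nimList n ⟩

  nimList : ℕ → List EGame
  nimList zero = []
  nimList (suc n) = nim n ∷ nimList n

Moon : EGame
Moon = ⟨ ∞ᴱ ∷ [] ∣ ∞̄ᴱ ∷ [] ⟩

SMoon : ℕ → List EGame → EGame
SMoon n A = ⟨ ⟨ ∞ᴱ ∷ [] ∣ nim n ∷ [] ⟩ ∷ A ∣ A ++ (⟨ nim n ∷ [] ∣ ∞̄ᴱ ∷ [] ⟩ ∷ []) ⟩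

data IsSMoon : EGame → Set where
  smoon : ∀ {G} (n : ℕ) (A : List EGame) →
          All (λ a → (Σ ℕ λ m → a ≅ nim m) ⊎ IsSMoon a) A →
          Any (λ a → a ≅ nim n) A →
          G ≅ SMoon n A → IsSMoon G

-- Mixed positions: finite disjunctive sums of entailing games and
-- impartial loopy games (positions of finite impartial game graphs)

data Comp : Set where
  ent  : EGame → Comp
  loop : (k : ℕ) → (Fin k → List (Fin k)) → Fin k → Comp

-- A position is a finite disjunctive sum of components; + is _++_.
Pos : Set
Pos = List Comp

data Player : Set where
  Left Right : Player

other : Player → Player
other Left = Right
other Right = Left

opts : Player → Comp → List Comp
opts _ (ent ∞ᴱ) = []
opts _ (ent ∞̄ᴱ) = []
opts Left (ent ⟨ L ∣ R ⟩) = map ent L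
opts Right (ent ⟨ L ∣ R ⟩) = map ent R
opts _ (loop k m v) = map (loop k m) (m v)

-- Step t P c Q : player t moves in one component of P, the moved
-- component becomes c, and the resulting position is Q
data Step (t : Player) : Pos → Comp → Pos → Set where
  here  : ∀ {c c' ps} → Any (λ x → x ≡ c') (opts t c) → Step t (c ∷ ps) c' (c' ∷ ps)
  there : ∀ {c c' ps qs} → Step t ps c' qs → Step t (c ∷ ps) c' (c ∷ qs)

-- moving a component to ∞ (resp. ∞̄) is an immediate win for Left (resp. Right)
Imm : Player → Comp → Set
Imm Left c = c ≡ ent ∞ᴱ
Imm Right c = c ≡ ent ∞̄ᴱ

-- Win p t P : player p can force a win from P when t is to move
-- (least fixed point: the win is reached after finitely many moves;
-- infinite play is not a win for anybody)
data Win (p : Player) : Player → Pos → Set where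
  attack : ∀ {P c Q} → Step p P c Q →
           Imm p c ⊎ (¬ Imm (other p) c × Win p (other p) Q) →
           Win p p P
  defend : ∀ {P} →
           (∀ {c Q} → Step (other p) P c Q →
              Imm p c ⊎ (¬ Imm (other p) c × Win p p Q)) →
           Win p (other p) P

data Outcome : Set where
  𝓛 𝓡 𝓝 𝓟 𝓓 : Outcome

HasOutcome : Pos → Outcome → Set
HasOutcome P 𝓛 = Win Left Left P × Win Left Right P
HasOutcome P 𝓡 = Win Right Right P × Win Right Left P
HasOutcome P 𝓝 = Win Left Left P × Win Right Right P
HasOutcome P 𝓟 = Win Right Left P × Win Left Right P
HasOutcome P 𝓓 = ¬ Win Left Left P × ¬ Win Right Left P ×
                 ¬ Win Left Right P × ¬ Win Right Right P

SameOutcome : Pos → Pos → Set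
SameOutcome P Q = ∀ o → HasOutcome P o ⇔ HasOutcome Q o

_=Im_ : EGame → EGame → Set
G =Im H = ∀ X → InIm X → SameOutcome (ent G ∷ ent X ∷ []) (ent H ∷ ent X ∷ [])

InIms : EGame → Set
InIms G = InIm G × ((Σ ℕ λ k → G =Im nim k) ⊎ (G ≅ Moon) ⊎ IsSMoon G)

-- ⟨ Ims~^∞ ∪ LIm~ ⟩ : finite sums whose entailing summands lie in Ims~^∞
-- and whose other summands are impartial loopy positions
InClassComp : Comp → Set
InClassComp (ent G) = InIms G
InClassComp (loop _ _ _) = ⊤

InClass : Pos → Set
InClass = All InClassComp

_≍_ : Pos → Pos → Set
G ≍ H = ∀ X → InClass X → SameOutcome (G ++ X) (H ++ X)

-- If p wins Q as second player, adding Q never spoils a win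
-- of p, who answers every opponent move in Q by the strategy for Q (win-++).
-- Dually, p may ignore a summand Q the opponent wins as second player: p
-- answers each of its own moves in Q by the opponent's counter-move there and
-- then follows its strategy on the whole sum (win-++⁻). Since G + X plus the
-- P-position H + H is a rearrangement of H + X plus the P-position G + H, each
-- player wins G + X from exactly the starts from which they win H + X.
module Submission where

open import Defs
open import Data.List using ([]; _∷_; _++_)
open import Data.List.Properties using (++-assoc)
open import Data.List.Relation.Binary.Permutation.Propositional
  using (_↭_; refl; prep; swap; trans; ↭-sym; module PermutationReasoning)
open import Data.List.Relation.Binary.Permutation.Propositional.Properties
  using (++-comm; shifts)
open import Data.Product using (Σ; _×_; _,_)
open import Data.Sum using (_⊎_; inj₁; inj₂)
open import Data.Empty using (⊥-elim)
open import Relation.Nullary using (¬_; contradiction)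
open import Relation.Binary.PropositionalEquality using (_≢_; refl; cong)
open import Function.Bundles using (mk⇔)

other-≢ : ∀ p → other p ≢ p
other-≢ Left ()
other-≢ Right ()

Imm-exclusive : ∀ p {c} → Imm p c → ¬ Imm (other p) c
Imm-exclusive Left refl ()
Imm-exclusive Right refl ()

OpponentContinues : Player → Comp → Set → Set
OpponentContinues p c B = Imm (other p) c ⊎ (¬ Imm p c × B)

WinAfter : Player → Comp → Player → Pos → Set
WinAfter p c t Q = Imm p c ⊎ (¬ Imm (other p) c × Win p t Q)

Imm-unanswerable : ∀ p {c B} → Imm p c → ¬ OpponentContinues p c B
Imm-unanswerable p i (inj₁ i') = Imm-exclusive p i i'
Imm-unanswerable p i (inj₂ (n , _)) = n i

step-↭ : ∀ {t P P' c Q} → P ↭ P' → Step t P c Q → Σ Pos λ Q' → Step t P' c Q' × Q ↭ Q'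
step-↭ refl m = _ , m , refl
step-↭ (prep x π) (here c) = _ , here c , prep _ π
step-↭ (prep x π) (there m) with step-↭ π m
... | _ , m' , π' = _ , there m' , prep x π'
step-↭ (swap x y π) (here c) = _ , there (here c) , swap _ y π
step-↭ (swap x y π) (there (here c)) = _ , here c , swap x _ π
step-↭ (swap x y π) (there (there m)) with step-↭ π m
... | _ , m' , π' = _ , there (there m') , swap x y π'
step-↭ (trans π₁ π₂) m with step-↭ π₁ m
... | _ , m₁ , π₁' with step-↭ π₂ m₁
... | _ , m₂ , π₂' = _ , m₂ , trans π₁' π₂'

mutual
  win-↭ : ∀ {p t P P'} → P ↭ P' → Win p t P → Win p t P'
  win-↭ π (attack m r) with step-↭ π m
  ... | _ , m' , π' = attack m' (winAfter-↭ π' r)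
  win-↭ {p} {P = P} π (defend f) = defend λ m → respond (step-↭ (↭-sym π) m)
    where
    respond : ∀ {c Q} → (Σ Pos λ Q' → Step (other p) P c Q' × Q ↭ Q') → WinAfter p c p Q
    respond (_ , m' , π') = winAfter-↭ (↭-sym π') (f m')

  winAfter-↭ : ∀ {p c t Q Q'} → Q ↭ Q' → WinAfter p c t Q → WinAfter p c t Q'
  winAfter-↭ π (inj₁ i) = inj₁ i
  winAfter-↭ π (inj₂ (n , w)) = inj₂ (n , win-↭ π w)

step-++ˡ : ∀ {t Q c Q'} Y → Step t Q c Q' → Step t (Q ++ Y) c (Q' ++ Y)
step-++ˡ Y (here c) = here c
step-++ˡ Y (there m) = there (step-++ˡ Y m)

step-++ʳ : ∀ {t Y c Y'} Q → Step t Y c Y' → Step t (Q ++ Y) c (Q ++ Y')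
step-++ʳ [] m = m
step-++ʳ (x ∷ Q) m = there (step-++ʳ Q m)

data Step-++ (t : Player) (Q Y : Pos) (c : Comp) : Pos → Set where
  inˡ : ∀ {Q'} → Step t Q c Q' → Step-++ t Q Y c (Q' ++ Y)
  inʳ : ∀ {Y'} → Step t Y c Y' → Step-++ t Q Y c (Q ++ Y')

step-++⁻ : ∀ {t c R} Q Y → Step t (Q ++ Y) c R → Step-++ t Q Y c R
step-++⁻ [] Y m = inʳ m
step-++⁻ (x ∷ Q) Y (here c) = inˡ (here c)
step-++⁻ (x ∷ Q) Y (there m) with step-++⁻ Q Y m
... | inˡ m' = inˡ (there m')
... | inʳ m' = inʳ m'

-- The hypothesis s ≢ p (rather than s ≡ other p) keeps the mover index a
-- variable, so that matching on the derivation can rule out attack.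
mutual
  win-++ : ∀ {p s t Q Y} → s ≢ p → Win p s Q → Win p t Y → Win p t (Q ++ Y)
  win-++ {Q = Q} s≢p wQ (attack m r) = attack (step-++ʳ Q m) (winAfter-++ s≢p wQ r)
  win-++ {Q = Q} {Y} s≢p wQ wY@(defend _) =
    defend λ m → respond-++ s≢p (other-≢ _) wQ wY (step-++⁻ Q Y m)

  winAfter-++ : ∀ {p s c t Q Y} → s ≢ p → Win p s Q → WinAfter p c t Y →
                WinAfter p c t (Q ++ Y)
  winAfter-++ _ _ (inj₁ i) = inj₁ i
  winAfter-++ s≢p wQ (inj₂ (n , w)) = inj₂ (n , win-++ s≢p wQ w)

  respond-++ : ∀ {p s u c Q Y R} → s ≢ p → u ≢ p → Win p s Q → Win p u Y →
               Step-++ u Q Y c R → WinAfter p c p R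
  respond-++ _ u≢p _ (attack _ _) _ = contradiction refl u≢p
  respond-++ s≢p _ wQ (defend f) (inʳ m) = winAfter-++ s≢p wQ (f m)
  respond-++ s≢p _ (attack _ _) (defend _) (inˡ _) = contradiction refl s≢p
  respond-++ {Y = Y} _ _ (defend g) wY@(defend _) (inˡ {Q'} m) =
    winAfter-↭ (++-comm Y Q') (winAfter-++ (other-≢ _) wY (g m))

-- Splitting on p is only needed to reduce other (other p) to p.
opponent-responds : ∀ p {Q c Q'} → Win (other p) p Q → Step p Q c Q' →
                    OpponentContinues p c (Win (other p) (other p) Q')
opponent-responds Left (defend g) = g
opponent-responds Right (defend g) = g

opponent-attacks : ∀ p {Q} → Win (other p) (other p) Q →
                   Σ Comp λ c → Σ Pos λ Q' →
                     Step (other p) Q c Q' × OpponentContinues p c (Win (other p) p Q')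
opponent-attacks Left (attack m r) = _ , _ , m , r
opponent-attacks Right (attack m r) = _ , _ , m , r

mutual
  win-++⁻ : ∀ {p t Q Y} → Win (other p) p Q → Win p t (Q ++ Y) → Win p t Y
  win-++⁻ {p} {Q = Q} {Y} wQ (attack m r) with step-++⁻ Q Y m | r
  ... | inʳ m' | _ = attack m' (winAfter-++⁻ wQ r)
  ... | inˡ m' | inj₁ i = ⊥-elim (Imm-unanswerable p i (opponent-responds p wQ m'))
  ... | inˡ m' | inj₂ (n , w) = win-++⁻-counter (other-≢ p) w (opponent-responds p wQ m') n
  win-++⁻ {Q = Q} wQ (defend f) = defend λ m → winAfter-++⁻ wQ (f (step-++ʳ Q m))

  winAfter-++⁻ : ∀ {p c t Q Y} → Win (other p) p Q → WinAfter p c t (Q ++ Y) →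
                 WinAfter p c t Y
  winAfter-++⁻ _ (inj₁ i) = inj₁ i
  winAfter-++⁻ wQ (inj₂ (n , w)) = inj₂ (n , win-++⁻ wQ w)

  win-++⁻-counter : ∀ {p s c Q' Y} → s ≢ p → Win p s (Q' ++ Y) →
                    OpponentContinues p c (Win (other p) (other p) Q') → ¬ Imm (other p) c →
                    Win p p Y
  win-++⁻-counter s≢p (attack _ _) _ _ = contradiction refl s≢p
  win-++⁻-counter _ _ (inj₁ i) n = contradiction i n
  win-++⁻-counter {p} {Y = Y} _ (defend h) (inj₂ (_ , w)) _ with opponent-attacks p w
  ... | _ , _ , m , ρ with h (step-++ˡ Y m) | ρ
  ...   | inj₁ i | _ = ⊥-elim (Imm-unanswerable p i ρ)
  ...   | inj₂ (n , _) | inj₁ i = contradiction i n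
  ...   | inj₂ (_ , w') | inj₂ (_ , wQ') = win-++⁻ wQ' w'

𝓟⇒second-wins : ∀ p {Q} → HasOutcome Q 𝓟 → Win p (other p) Q
𝓟⇒second-wins Left (_ , w) = w
𝓟⇒second-wins Right (w , _) = w

𝓟⇒opponent-second-wins : ∀ p {Q} → HasOutcome Q 𝓟 → Win (other p) p Q
𝓟⇒opponent-second-wins Left (w , _) = w
𝓟⇒opponent-second-wins Right (_ , w) = w

win-exchange : ∀ {p t Q₁ Q₂ Y₁ Y₂} → HasOutcome Q₁ 𝓟 → HasOutcome Q₂ 𝓟 →
               Q₁ ++ Y₁ ↭ Q₂ ++ Y₂ → Win p t Y₁ → Win p t Y₂
win-exchange {p} q₁ q₂ π w =
  win-++⁻ (𝓟⇒opponent-second-wins p q₂) (win-↭ π (win-++ (other-≢ p) (𝓟⇒second-wins p q₁) w))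

wins⇒sameOutcome : ∀ {P Q} → (∀ {p t} → Win p t P → Win p t Q) →
                   (∀ {p t} → Win p t Q → Win p t P) → SameOutcome P Q
wins⇒sameOutcome to from o = mk⇔ (transfer to from o) (transfer from to o)
  where
  transfer : ∀ {P Q} → (∀ {p t} → Win p t P → Win p t Q) →
             (∀ {p t} → Win p t Q → Win p t P) → ∀ o → HasOutcome P o → HasOutcome Q o
  transfer f _ 𝓛 (a , b) = f a , f b
  transfer f _ 𝓡 (a , b) = f a , f b
  transfer f _ 𝓝 (a , b) = f a , f b
  transfer f _ 𝓟 (a , b) = f a , f b
  transfer _ g 𝓓 (a , b , c , d) =
    (λ w → a (g w)) , (λ w → b (g w)) , (λ w → c (g w)) , (λ w → d (g w))

exchange-pairs : ∀ (A B X : Pos) → (A ++ A) ++ (B ++ X) ↭ (B ++ A) ++ (A ++ X)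
exchange-pairs A B X = begin
  (A ++ A) ++ B ++ X  ↭⟨ shifts (A ++ A) B ⟩
  B ++ (A ++ A) ++ X  ≡⟨ cong (B ++_) (++-assoc A A X) ⟩
  B ++ A ++ A ++ X    ≡⟨ ++-assoc B A (A ++ X) ⟨
  (B ++ A) ++ A ++ X  ∎
  where open PermutationReasoning

mainTheorem7 : (G H : Pos) → InClass G → InClass H →
    HasOutcome (G ++ H) 𝓟 → HasOutcome (H ++ H) 𝓟 → G ≍ H
mainTheorem7 G H _ _ gh hh X _ = wins⇒sameOutcome
  (win-exchange hh gh (exchange-pairs H G X))
  (win-exchange gh hh (↭-sym (exchange-pairs H G X)))
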